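{- Let $\mathcal B,\mathcal B^*$ be matroids on a finite set $X$ and $B\mapsto B^*$ a linking $\mathcal B\to\mathcal B^*$; let $\omega,\pi,a,z,\varepsilon$ and the map $\sigma:\mathcal B\to\mathcal B$ be as in the context. Then for $B\in\mathcal B$, $\sigma(B)\ne B$ if and only if either $B$ is a branching image in $\mathcal B$ or $B^*$ is a branching image in $\mathcal B^*$.
   Context: A pre-matroid on a finite set $X$ is a non-empty set of subsets of $X$ (bases). For $Y\subseteq X$, $x\notin Y$, $Y+x=Y\cup\{x\}$; for $y\in Y$, $Y-y=Y\setminus\{y\}$. An almost-basis of a pre-matroid $\mathcal C$ is $B-x$ with $B\in\mathcal C$, $x\in B$; $U(D)=\{x\notin D: D+x\in\mathcal C\}$. A matroid is a pre-matroid such that for all bases $B_1,B_2$ and $x\in B_1\setminus B_2$ there is $y\in B_2\setminus B_1$ with $B_1-x+y$ a basis. A transposition exchanges two distinct elements of $X$ and fixes the rest; it acts on subsets elementwise. A bijection $\mathcal B\to\mathcal B^*$, $B\mapsto B^*$, is a linking if for all $B\in\mathcal B$ and transpositions $\tau$: (L1) if $\tau(B)\in\mathcal B$ then $\tau(B^*)\in\mathcal B^*$ and $\tau(B^*)=\tau(B)^*$; (L2) if $\tau(B^*)\in\mathcal B^*$ then $\tau(B)\in\mathcal B$ and $\tau(B^*)=\tau(B)^*$. For a linear order $\rho$ and an almost-basis $D$ of a pre-matroid, $\varphi_\rho(D)=D+\min_\rho U(D)$ (computed in that pre-matroid). Let $\omega$ be a linear order on $X$, $a\ne z$ consecutive for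 $\omega$ with $a<_\omega z$, $\varepsilon$ the transposition of $a,z$, and $\pi$ the linear order agreeing with $\omega$ except $z<_\pi a$. An almost-basis $D$ is branching if $\varphi_\omega(D)\ne\varphi_\pi(D)$. A basis is a branching image if it equals $\varphi_\omega(A)$ or $\varphi_\pi(A)$ for some branching almost-basis $A$ of the same pre-matroid. For $B\in\mathcal B$ let $\varepsilon_B=\varepsilon$ if $B$ is a branching image in $\mathcal B$ or $B^*$ is a branching image in $\mathcal B^*$, and $\varepsilon_B=\mathrm{id}_X$ otherwise; put $\sigma(B)=\varepsilon_B(B)$ (this lies in $\mathcal B$). -}

module Defs where

open import Data.Nat using (ℕ; suc)
open import Data.Fin using (Fin; _<_)
open import Data.Fin.Subset using (Subset; _∈_; _∉_; _∪_; ⁅_⁆; _-_)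
open import Data.Fin.Permutation using (Permutation′; _⟨$⟩ʳ_)
import Data.Fin.Permutation.Components as PC
open import Data.Vec using (tabulate; lookup)
open import Data.Product using (Σ; ∃; _×_)
open import Data.Sum using (_⊎_)
open import Relation.Nullary using (¬_; Dec; yes; no)
open import Relation.Binary.PropositionalEquality using (_≡_; _≢_)

-- The ground set X is Fin n; subsets of X are Data.Fin.Subset.
-- A pre-matroid is given by the predicate "is a basis" on subsets.
PreMatroid : ℕ → Set₁
PreMatroid n = Subset n → Set

NonEmpty : ∀ {n} → PreMatroid n → Set
NonEmpty {n} 𝒞 = Σ (Subset n) 𝒞

_+ₛ_ : ∀ {n} → Subset n → Fin n → Subset n
Y +ₛ x = Y ∪ ⁅ x ⁆

IsMatroid : ∀ {n} → PreMatroid n → Set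
IsMatroid {n} 𝒞 =
  NonEmpty 𝒞 ×
  (∀ (B₁ B₂ : Subset n) (x : Fin n) → 𝒞 B₁ → 𝒞 B₂ → x ∈ B₁ → x ∉ B₂ →
     ∃ λ y → y ∈ B₂ × y ∉ B₁ × 𝒞 ((B₁ - x) +ₛ y))

transp : ∀ {n} → Fin n → Fin n → Fin n → Fin n
transp i j = PC.transpose i j

-- Action of a map τ on X which is an involution (transpositions and the
-- identity) on subsets, elementwise: i ∈ τ(S) iff τ(i) ∈ S.
act : ∀ {n} → (Fin n → Fin n) → Subset n → Subset n
act τ S = tabulate (λ i → lookup S (τ i))

actT : ∀ {n} → Fin n → Fin n → Subset n → Subset n
actT i j = act (transp i j)

-- A linking 𝓑 → 𝓑*, given by a function star on all subsets whose
-- restriction to 𝓑 is a bijection onto 𝓑* satisfying (L1) and (L2).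
IsLinking : ∀ {n} → PreMatroid n → PreMatroid n → (Subset n → Subset n) → Set
IsLinking {n} 𝓑 𝓑* star =
  (∀ B → 𝓑 B → 𝓑* (star B)) ×
  (∀ B B′ → 𝓑 B → 𝓑 B′ → star B ≡ star B′ → B ≡ B′) ×
  (∀ C → 𝓑* C → ∃ λ B → 𝓑 B × star B ≡ C) ×
  (∀ B (i j : Fin n) → i ≢ j → 𝓑 B → 𝓑 (actT i j B) →
     𝓑* (actT i j (star B)) × actT i j (star B) ≡ star (actT i j B)) ×
  (∀ B (i j : Fin n) → i ≢ j → 𝓑 B → 𝓑* (actT i j (star B)) →
     𝓑 (actT i j B) × actT i j (star B) ≡ star (actT i j B))

-- Linear orders on Fin n, given by a rank bijection ρ : X ≅ Fin n.
LinOrder : ℕ → Set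
LinOrder n = Permutation′ n

_<[_]_ : ∀ {n} → Fin n → LinOrder n → Fin n → Set
x <[ ρ ] y = (ρ ⟨$⟩ʳ x) < (ρ ⟨$⟩ʳ y)

AlmostBasis : ∀ {n} → PreMatroid n → Subset n → Set
AlmostBasis 𝒞 D = ∃ λ B → ∃ λ x → 𝒞 B × x ∈ B × D ≡ B - x

InU : ∀ {n} → PreMatroid n → Subset n → Fin n → Set
InU 𝒞 D x = x ∉ D × 𝒞 (D +ₛ x)

IsMinU : ∀ {n} → LinOrder n → PreMatroid n → Subset n → Fin n → Set
IsMinU ρ 𝒞 D x = InU 𝒞 D x × (∀ y → InU 𝒞 D y → y ≡ x ⊎ x <[ ρ ] y)

Phi : ∀ {n} → LinOrder n → PreMatroid n → Subset n → Subset n → Set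
Phi ρ 𝒞 D S = ∃ λ x → IsMinU ρ 𝒞 D x × S ≡ D +ₛ x

Branching : ∀ {n} → LinOrder n → LinOrder n → PreMatroid n → Subset n → Set
Branching {n} ω π 𝒞 D =
  AlmostBasis 𝒞 D ×
  Σ (Subset n) λ S → Σ (Subset n) λ T → Phi ω 𝒞 D S × Phi π 𝒞 D T × S ≢ T

BranchingImage : ∀ {n} → LinOrder n → LinOrder n → PreMatroid n → Subset n → Set
BranchingImage {n} ω π 𝒞 B =
  Σ (Subset n) λ A → Branching ω π 𝒞 A × (Phi ω 𝒞 A B ⊎ Phi π 𝒞 A B)

EpsCond : ∀ {n} → LinOrder n → LinOrder n → PreMatroid n → PreMatroid n →
          (Subset n → Subset n) → Subset n → Set
EpsCond ω π 𝓑 𝓑* star B = BranchingImage ω π 𝓑 B ⊎ BranchingImage ω π 𝓑* (star B)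

σ : ∀ {n} (ω π : LinOrder n) (𝓑 𝓑* : PreMatroid n) (star : Subset n → Subset n)
    (a z : Fin n) (B : Subset n) → Dec (EpsCond ω π 𝓑 𝓑* star B) → Subset n
σ ω π 𝓑 𝓑* star a z B (yes _) = actT a z B
σ ω π 𝓑 𝓑* star a z B (no _)  = act (λ i → i) B

ConsecutiveIn : ∀ {n} → LinOrder n → Fin n → Fin n → Set
ConsecutiveIn ω a z =
  a <[ ω ] z × (∀ w → ¬ (a <[ ω ] w × w <[ ω ] z))

SwapOrder : ∀ {n} → LinOrder n → LinOrder n → Fin n → Fin n → Set
SwapOrder ω π a z =
  z <[ π ] a ×
  (∀ x y → ¬ (x ≡ a × y ≡ z) → ¬ (x ≡ z × y ≡ a) → (x <[ π ] y → x <[ ω ] y)) ×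
  (∀ x y → ¬ (x ≡ a × y ≡ z) → ¬ (x ≡ z × y ≡ a) → (x <[ ω ] y → x <[ π ] y))

-- A branching almost-basis A has distinct minima x = min_ω U(A) and
-- y = min_π U(A), so x <_ω y and y <_π x; as ω and π differ only on the pair
-- {a, z}, we get {x, y} = {a, z}.  Hence each of the images A + x, A + y
-- contains exactly one of a, z, and ε moves it.  If B* is the branching image
-- and ε fixed B, then (L1) would give ε(B*) = ε(B)* = B*, which is impossible.
module Submission where

open import Defs
open import Data.Nat using (ℕ)
open import Data.Fin using (Fin; _≟_)
open import Data.Fin.Properties using (<-asym)
open import Data.Fin.Subset using (Subset; _∈_; _∉_)
open import Data.Fin.Subset.Properties using (x∈⁅x⁆; x∈⁅y⁆⇒x≡y; x∈p∪q⁻; x∈p∪q⁺)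
import Data.Fin.Permutation.Components as PC
open import Data.Vec using (lookup)
open import Data.Vec.Properties using ([]=⇒lookup; lookup⇒[]=; lookup∘tabulate; tabulate∘lookup)
open import Data.Product using (_×_; _,_; proj₁; proj₂; swap)
open import Data.Sum using (_⊎_; inj₁; inj₂)
open import Data.Empty using (⊥-elim)
open import Function using (_∘_)
open import Function.Bundles using (_⇔_; mk⇔)
open import Relation.Nullary using (Dec; yes; no)
open import Relation.Nullary.Decidable using (dec-true; _×-dec_)
open import Relation.Binary.PropositionalEquality

module _ {n : ℕ} where

  Separates : Fin n → Fin n → Subset n → Set
  Separates a z S = (a ∈ S × z ∉ S) ⊎ (z ∈ S × a ∉ S)

  Separates-sym : ∀ {a z S} → Separates a z S → Separates z a S
  Separates-sym (inj₁ p) = inj₂ p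
  Separates-sym (inj₂ p) = inj₁ p

  transpose-left : (a z : Fin n) → PC.transpose a z a ≡ z
  transpose-left a z rewrite dec-true (a ≟ a) refl = refl

  act-id : (S : Subset n) → act (λ i → i) S ≡ S
  act-id = tabulate∘lookup

  actT-fixed⇒lookup≡ : (a z : Fin n) (S : Subset n) → actT a z S ≡ S → lookup S z ≡ lookup S a
  actT-fixed⇒lookup≡ a z S eq = begin
    lookup S z                       ≡⟨ cong (lookup S) (transpose-left a z) ⟨
    lookup S (PC.transpose a z a)    ≡⟨ lookup∘tabulate _ a ⟨
    lookup (actT a z S) a            ≡⟨ cong (λ T → lookup T a) eq ⟩
    lookup S a                       ∎
    where open ≡-Reasoning

  actT-moves-separated : (a z : Fin n) (S : Subset n) → Separates a z S → actT a z S ≢ S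
  actT-moves-separated a z S (inj₁ (a∈S , z∉S)) eq =
    z∉S (lookup⇒[]= z S (trans (actT-fixed⇒lookup≡ a z S eq) ([]=⇒lookup a∈S)))
  actT-moves-separated a z S (inj₂ (z∈S , a∉S)) eq =
    a∉S (lookup⇒[]= a S (trans (sym (actT-fixed⇒lookup≡ a z S eq)) ([]=⇒lookup z∈S)))

  A+ₛx-separates : (A : Subset n) {x y : Fin n} → y ∉ A → y ≢ x → Separates x y (A +ₛ x)
  A+ₛx-separates A {x} y∉A y≢x = inj₁ (x∈p∪q⁺ (inj₂ (x∈⁅x⁆ x)) , y∉A+x)
    where
      y∉A+x : _ ∉ A +ₛ x
      y∉A+x y∈A+x with x∈p∪q⁻ A _ y∈A+x
      ... | inj₁ y∈A   = y∉A y∈A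
      ... | inj₂ y∈⁅x⁆ = y≢x (x∈⁅y⁆⇒x≡y x y∈⁅x⁆)

  IsMinU-unique : ∀ (ρ : LinOrder n) (𝒞 : PreMatroid n) D {x x′} →
                  IsMinU ρ 𝒞 D x → IsMinU ρ 𝒞 D x′ → x ≡ x′
  IsMinU-unique ρ 𝒞 D (x∈U , x-min) (x′∈U , x′-min) with x-min _ x′∈U | x′-min _ x∈U
  ... | inj₁ x′≡x | _          = sym x′≡x
  ... | inj₂ _    | inj₁ x≡x′  = x≡x′
  ... | inj₂ x<x′ | inj₂ x′<x  = ⊥-elim (<-asym x<x′ x′<x)

  IsMinU⇒< : ∀ (ρ : LinOrder n) (𝒞 : PreMatroid n) D {x y} →
             IsMinU ρ 𝒞 D x → InU 𝒞 D y → x ≢ y → x <[ ρ ] y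
  IsMinU⇒< ρ 𝒞 D (_ , x-min) y∈U x≢y with x-min _ y∈U
  ... | inj₁ y≡x = ⊥-elim (x≢y (sym y≡x))
  ... | inj₂ x<y = x<y

  Phi-separates : ∀ (ω π : LinOrder n) (𝒞 : PreMatroid n) A B {x y} →
                  IsMinU ω 𝒞 A x → IsMinU π 𝒞 A y → x ≢ y →
                  Phi ω 𝒞 A B ⊎ Phi π 𝒞 A B → Separates x y B
  Phi-separates ω π 𝒞 A _ {x} {y} x-min y-min x≢y (inj₁ (x′ , x′-min , refl)) =
    subst (λ w → Separates x y (A +ₛ w)) (IsMinU-unique ω 𝒞 A x-min x′-min)
      (A+ₛx-separates A (proj₁ (proj₁ y-min)) (x≢y ∘ sym))
  Phi-separates ω π 𝒞 A _ {x} {y} x-min y-min x≢y (inj₂ (y′ , y′-min , refl)) =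
    subst (λ w → Separates x y (A +ₛ w)) (IsMinU-unique π 𝒞 A y-min y′-min)
      (Separates-sym (A+ₛx-separates A (proj₁ (proj₁ x-min)) x≢y))

  reversed-pair : ∀ (ω π : LinOrder n) a z {x y} → SwapOrder ω π a z →
                  x <[ ω ] y → y <[ π ] x → (x ≡ a × y ≡ z) ⊎ (x ≡ z × y ≡ a)
  reversed-pair ω π a z {x} {y} (_ , π⇒ω , _) x<y y<x
    with (x ≟ a) ×-dec (y ≟ z) | (x ≟ z) ×-dec (y ≟ a)
  ... | yes az | _      = inj₁ az
  ... | _      | yes za = inj₂ za
  ... | no ¬az | no ¬za = ⊥-elim (<-asym x<y (π⇒ω y x (¬za ∘ swap) (¬az ∘ swap) y<x))

  minima-separate : ∀ (ω π : LinOrder n) a z (𝒞 : PreMatroid n) A B {x y} →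
                    SwapOrder ω π a z →
                    IsMinU ω 𝒞 A x → IsMinU π 𝒞 A y → x ≢ y →
                    Phi ω 𝒞 A B ⊎ Phi π 𝒞 A B → Separates a z B
  minima-separate ω π a z 𝒞 A B {x} {y} swapped x-min y-min x≢y B-image
    with reversed-pair ω π a z swapped (IsMinU⇒< ω 𝒞 A x-min (proj₁ y-min) x≢y)
                                        (IsMinU⇒< π 𝒞 A y-min (proj₁ x-min) (x≢y ∘ sym))
  ... | inj₁ (refl , refl) = Phi-separates ω π 𝒞 A B x-min y-min x≢y B-image
  ... | inj₂ (refl , refl) = Separates-sym (Phi-separates ω π 𝒞 A B x-min y-min x≢y B-image)

  BranchingImage-separates : ∀ (ω π : LinOrder n) a z (𝒞 : PreMatroid n) {B} →
                             SwapOrder ω π a z →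
                             BranchingImage ω π 𝒞 B → Separates a z B
  BranchingImage-separates ω π a z 𝒞 {B} swapped
    (A , (_ , _ , _ , (x , x-min , S≡A+x) , (y , y-min , T≡A+y) , S≢T) , B-image) =
    minima-separate ω π a z 𝒞 A B swapped x-min y-min
      (λ x≡y → S≢T (trans S≡A+x (trans (cong (A +ₛ_) x≡y) (sym T≡A+y))))
      B-image

  linking-preserves-fixed : ∀ {𝓑 𝓑* : PreMatroid n} {star a z B} →
                            IsLinking 𝓑 𝓑* star → a ≢ z → 𝓑 B →
                            actT a z B ≡ B → actT a z (star B) ≡ star B
  linking-preserves-fixed {𝓑 = 𝓑} {star = star} (_ , _ , _ , L1 , _) a≢z B∈𝓑 fixed =
    trans (proj₂ (L1 _ _ _ a≢z B∈𝓑 (subst 𝓑 (sym fixed) B∈𝓑))) (cong star fixed)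

lemma10p1 : ∀ {n : ℕ} (𝓑 𝓑* : PreMatroid n) (star : Subset n → Subset n)
    (ω π : LinOrder n) (a z : Fin n) →
    IsMatroid 𝓑 → IsMatroid 𝓑* → IsLinking 𝓑 𝓑* star →
    a ≢ z → ConsecutiveIn ω a z → SwapOrder ω π a z →
    ∀ (B : Subset n) → 𝓑 B →
    (d : Dec (EpsCond ω π 𝓑 𝓑* star B)) →
    (σ ω π 𝓑 𝓑* star a z B d ≢ B) ⇔ EpsCond ω π 𝓑 𝓑* star B
lemma10p1 𝓑 𝓑* star ω π a z _ _ _ _ _ _ B _ (no ¬cond) =
  mk⇔ (λ moved → ⊥-elim (moved (act-id B))) (λ cond → ⊥-elim (¬cond cond))
lemma10p1 𝓑 𝓑* star ω π a z _ _ linking a≢z _ swapped B B∈𝓑 (yes cond) =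
  mk⇔ (λ _ → cond) moves
  where
    moves : EpsCond ω π 𝓑 𝓑* star B → actT a z B ≢ B
    moves (inj₁ image) = actT-moves-separated a z B (BranchingImage-separates ω π a z 𝓑 swapped image)
    moves (inj₂ image*) =
      actT-moves-separated a z (star B) (BranchingImage-separates ω π a z 𝓑* swapped image*)
      ∘ linking-preserves-fixed linking a≢z B∈𝓑
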